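{- Let $n\geq 2$, $\overline{m}=(m_1,\dots,m_n)\in\mathbb{N}^n$ with $m_1\leq\dots\leq m_n$, and let $K_{\overline{m}}$ be the complete $n$-partite graph with parts $V_1,\dots,V_n$, $|V_j|=m_j$. Let $S$ be a complete play of the edge domination game on $K_{\overline{m}}$ which is a 2-1 play, in which Dominator follows an optimal strategy and Staller plays a semi-greedy strategy. If $|V(K_{\overline{m}})\setminus C_S|\geq 2$, then $$\gamma_{e,g}(K_{\overline{m}})\geq |S|\geq 2\max\left\{\left\lceil\tfrac12\sum_{j=1}^{n-1}m_j\right\rceil,\ m_{n-1}\right\}-1.$$
   Context: For an edge $e$ of a graph $G$, $N[e]$ denotes $e$ together with all edges sharing an endpoint with $e$. In the edge domination game on $G$, Dominator and Staller alternately choose edges, Dominator first (odd-numbered moves Dominator, even-numbered moves Staller); each chosen edge $s_i$ must satisfy $N[s_i]\setminus\bigcup_{j<i}N[s_j]\neq\emptyset$; the game ends when all edges lie in $\bigcup_jN[s_j]$. Dominator minimizes and Staller maximizes the number of moves; $\gamma_{e,g}(G)$ is the number of moves under optimal play. An optimal strategy for Dominator is one guaranteeing at most $\gamma_{e,g}(G)$ moves against every Staller play. For a play $S=s_1\dots s_{|S|}$, $C_{S,i}$ is the set of endpoints of $s_1,\dots,s_i$ ($C_{S,0}=\emptyset$), $C_S=C_{S,|S|}$. $S$ is a 2-1 play if for odd $i$, $|C_{S,i}\setminus C_{S,i-1}|=2$ and for even $i$, $|C_{S,i}\setminus C_{S,i-1}|=1$. The complete $n$-partite graph $K_{\overline{m}}$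 has vertex set the disjoint union of independent sets $V_1,\dots,V_n$, vertices in different parts adjacent. Staller plays semi-greedily in $S$ if for each even $i$, after ordering the parts as $V_{l_1},\dots,V_{l_n}$ so that $|V_{l_1}\setminus C_{S,i-1}|\leq\dots\leq|V_{l_n}\setminus C_{S,i-1}|$, Staller chooses an edge covering exactly one new vertex $c_i$ such that: $c_i\in V_{l_n}$ if $|V_{l_n}\setminus C_{S,i-1}|>|V_{l_{n-1}}\setminus C_{S,i-1}|$; $c_i\in V(K_{\overline{m}})\setminus(V_{l_{n-1}}\cup V_{l_n})$ if these two numbers are equal and some vertex outside $V_{l_{n-1}}\cup V_{l_n}$ is not in $C_{S,i-1}$; and $c_i\in V_{l_{n-1}}\cup V_{l_n}$ if they are equal and all vertices outside $V_{l_{n-1}}\cup V_{l_n}$ are in $C_{S,i-1}$. -}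

module Defs where

open import Data.Nat using (ℕ; zero; suc; s≤s; _+_; _*_; _∸_; _≤_; _<_; _⊔_; _/_; _<?_)
open import Data.Fin as Fin using (Fin; toℕ; fromℕ; inject₁)
open import Data.Fin.Properties using () renaming (_≟_ to _≟ᶠ_)
open import Data.List using (List; []; _∷_; _++_; [_]; length; filter; map; allFin)
open import Data.Nat.ListAction using (sum)
open import Data.List.Relation.Unary.Any using (Any; any?)
open import Data.Product using (Σ; ∃; _×_; _,_; proj₁; proj₂)
open import Data.Product.Properties using (≡-dec)
open import Data.Sum using (_⊎_)
open import Relation.Nullary using (¬_; Dec; yes; no)
open import Relation.Nullary.Decidable using (¬?; _⊎-dec_)
open import Relation.Binary.PropositionalEquality using (_≡_; _≢_)

ceilHalf : ℕ → ℕ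
ceilHalf x = (x + 1) / 2

-- the index (0-based) n-2 of Fin n, i.e. the part V_{n-1} in 1-based numbering
secondLast : (n : ℕ) → 2 ≤ n → Fin n
secondLast (suc (suc k)) _ = inject₁ (fromℕ k)
secondLast (suc zero) (s≤s ())

-- sum of m_j over 1-based j = 1 .. n-1, i.e. all parts but the last
sumButLast : {n : ℕ} → (Fin n → ℕ) → ℕ
sumButLast {n} m = sum (map m (filter (λ j → toℕ j <? (n ∸ 1)) (allFin n)))

-- Complete n-partite graph K_m with parts V_j = {j} × Fin (m j)
module Game {n : ℕ} (m : Fin n → ℕ) where

  Vertex : Set
  Vertex = Σ (Fin n) (λ j → Fin (m j))

  part : Vertex → Fin n
  part = proj₁

  _≟ᵛ_ : (x y : Vertex) → Dec (x ≡ y)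
  _≟ᵛ_ = ≡-dec _≟ᶠ_ _≟ᶠ_

  Move : Set
  Move = Vertex × Vertex

  IsEdge : Move → Set
  IsEdge (u , v) = part u ≢ part v

  -- f ∈ N[e] : f shares an endpoint with e (this includes f = e)
  _∈N_ : Move → Move → Set
  (x , y) ∈N (u , v) = (x ≡ u ⊎ x ≡ v) ⊎ (y ≡ u ⊎ y ≡ v)

  Dominated : List Move → Move → Set
  Dominated h f = Any (λ s → f ∈N s) h

  Legal : List Move → Move → Set
  Legal h e = IsEdge e × Σ Move (λ f → IsEdge f × f ∈N e × ¬ Dominated h f)

  Finished : List Move → Set
  Finished h = (f : Move) → IsEdge f → Dominated h f

  data Player : Set where
    dominator staller : Player

  -- Forces p k h : from history h with player p to move,
  -- Dominator can force the game to end within at most k further moves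
  data Forces : Player → ℕ → List Move → Set where
    done  : ∀ {p k h} → Finished h → Forces p k h
    dmove : ∀ {k h} (e : Move) → Legal h e →
            Forces staller k (h ++ [ e ]) → Forces dominator (suc k) h
    smove : ∀ {k h} → ((e : Move) → Legal h e →
            Forces dominator k (h ++ [ e ])) → Forces staller (suc k) h

  IsGameValue : ℕ → Set
  IsGameValue g = Forces dominator g [] × ((k : ℕ) → Forces dominator k [] → g ≤ k)

  Strategy : Set
  Strategy = List Move → Move

  data SForces (σ : Strategy) : Player → ℕ → List Move → Set where
    done  : ∀ {p k h} → Finished h → SForces σ p k h
    dmove : ∀ {k h} → Legal h (σ h) →
            SForces σ staller k (h ++ [ σ h ]) → SForces σ dominator (suc k) h
    smove : ∀ {k h} → ((e : Move) → Legal h e →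
            SForces σ dominator k (h ++ [ e ])) → SForces σ staller (suc k) h

  Optimal : ℕ → Strategy → Set
  Optimal g σ = SForces σ dominator g []

  Covered : List Move → Vertex → Set
  Covered h w = Any (λ s → w ≡ proj₁ s ⊎ w ≡ proj₂ s) h

  covered? : (h : List Move) → (w : Vertex) → Dec (Covered h w)
  covered? h w = any? (λ s → (w ≟ᵛ proj₁ s) ⊎-dec (w ≟ᵛ proj₂ s)) h

  uncov : List Move → Fin n → ℕ
  uncov h j = length (filter (λ k → ¬? (covered? h (j , k))) (allFin (m j)))

  uncovTotal : List Move → ℕ
  uncovTotal h = sum (map (uncov h) (allFin n))

  -- |C_{h e} ∖ C_h| = 2 (the endpoints of an edge are distinct)
  TwoNew : List Move → Move → Set
  TwoNew h (u , v) = ¬ Covered h u × ¬ Covered h v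

  -- |C_{h e} ∖ C_h| = 1 and c is the unique new vertex
  OneNew : List Move → Move → Vertex → Set
  OneNew h (u , v) c = (c ≡ u × ¬ Covered h u × Covered h v)
                     ⊎ (c ≡ v × ¬ Covered h v × Covered h u)

  -- Staller's move e after history h is semi-greedy.
  -- a = l_n and b = l_{n-1} in some ordering of the parts that is
  -- nondecreasing in |V_l ∖ C_h|.
  SemiGreedy : List Move → Move → Set
  SemiGreedy h e =
    Σ (Fin n) λ a → Σ (Fin n) λ b →
      a ≢ b × uncov h b ≤ uncov h a ×
      ((j : Fin n) → j ≢ a → j ≢ b → uncov h j ≤ uncov h b) ×
      Σ Vertex λ c → OneNew h e c ×
        (uncov h b < uncov h a → part c ≡ a) ×
        (uncov h a ≡ uncov h b →
          Σ Vertex (λ w → part w ≢ a × part w ≢ b × ¬ Covered h w) →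
          part c ≢ a × part c ≢ b) ×
        (uncov h a ≡ uncov h b →
          ((w : Vertex) → part w ≢ a → part w ≢ b → Covered h w) →
          part c ≡ a ⊎ part c ≡ b)

module Submission where

-- Let U t j be the number of uncovered vertices of part j after t moves. In a 2-1 play a
-- Dominator move lowers two entries of U by one and a Staller move lowers one. When the
-- play ends only one part p still has uncovered vertices, at least two of them. Reading the
-- play backwards, every Staller move was made in p: just before it p either strictly led
-- all other parts, or tied with exactly one other part while a third part was non-empty,
-- and in both cases the semi-greedy rule picks p. So each round of two moves lowers every
-- part other than p by at most one and all of them together by at most two. If |S| = 2s + 1,
-- every part other than p therefore has at most B = s + 1 vertices and all of them together
-- at most 2B; since the parts are sorted this gives m_(n-1) ≤ B and
-- ⌈(m_1 + ... + m_(n-1)) / 2⌉ ≤ B. A play of positive even length is impossible, as its last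
-- Staller move would have to be made in p although two parts were still non-empty.

open import Defs
open import Data.Nat using (ℕ; zero; suc; _+_; _*_; _∸_; _≤_; _<_; _⊔_; _%_; _<?_; z≤n; s≤s; s≤s⁻¹; z<s)
open import Data.Nat.Properties
open import Data.Nat.ListAction using (sum)
open import Algebra.Properties.CommutativeMonoid.Sum +-0-commutativeMonoid
  using (sum-remove; sum-cong-≗; sum-replicate-zero; sum-init-last) renaming (sum to ∑)
open import Data.Fin as Fin using (Fin; toℕ; fromℕ; fromℕ<; inject₁; punchIn)
open import Data.Fin.Properties
  using (any?; punchInᵢ≢i; toℕ-fromℕ<; toℕ-fromℕ; toℕ-inject₁; toℕ<n; fromℕ≢inject₁; ≤fromℕ)
  renaming (_≟_ to _≟ᶠ_)
open import Data.Nat.DivMod using (m<n*o⇒m/o<n)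
open import Data.Vec.Functional using (removeAt; updateAt; init)
open import Data.Vec.Functional.Properties using (updateAt-updates; updateAt-minimal)
open import Data.List.Properties using (take-suc; take-all; map-tabulate)
open import Data.List using (List; []; _++_; [_]; length; take; lookup; map; filter; tabulate)
open import Data.Product using (Σ-syntax; ∃-syntax; _×_; _,_; proj₁; proj₂)
open import Data.Sum using (_⊎_; inj₁; inj₂; [_,_]′)
open import Data.List.Relation.Unary.Any as Any using (here)
open import Data.List.Relation.Unary.Any.Properties using (++⁺ˡ; ++⁺ʳ; ++⁻; singleton⁻; Any-⊎⁻)
open import Data.Empty using (⊥; ⊥-elim)
open import Function using (_∘_; id; flip; _⇔_; Equivalence; mk⇔)
open import Data.Nat.Tactic.RingSolver using (solve-∀)
open import Relation.Nullary using (¬_; Dec; yes; no; contradiction)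
open import Relation.Nullary.Decidable using (¬?; _×-dec_)
open import Relation.Binary.PropositionalEquality hiding ([_])
open import Relation.Unary using (Decidable)

private variable
  N : ℕ

Decrement : Fin N → (Fin N → ℕ) → (Fin N → ℕ) → Set
Decrement c v w = v c ≡ suc (w c) × (∀ x → x ≢ c → v x ≡ w x)

DoubleDecrement : (Fin N → ℕ) → (Fin N → ℕ) → Set
DoubleDecrement {N} v w = Σ[ i ∈ Fin N ] Σ[ j ∈ Fin N ]
  i ≢ j × v i ≡ suc (w i) × v j ≡ suc (w j) × (∀ x → x ≢ i → x ≢ j → v x ≡ w x)

∑-update : ∀ {f g : Fin N → ℕ} c k → g c ≡ k + f c → (∀ x → x ≢ c → g x ≡ f x) → ∑ g ≡ k + ∑ f
∑-update {suc N} {f} {g} c k gc rest = begin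
  ∑ g                           ≡⟨ sum-remove {i = c} g ⟩
  g c + ∑ (removeAt g c)        ≡⟨ cong₂ _+_ gc (sum-cong-≗ λ j → rest (punchIn c j) (punchInᵢ≢i c j)) ⟩
  k + f c + ∑ (removeAt f c)    ≡⟨ +-assoc k (f c) _ ⟩
  k + (f c + ∑ (removeAt f c))  ≡⟨ cong (k +_) (sum-remove {i = c} f) ⟨
  k + ∑ f                       ∎
  where open ≡-Reasoning

∑-decrement : ∀ {c} {v w : Fin N → ℕ} → Decrement c v w → ∑ v ≡ suc (∑ w)
∑-decrement {c = c} (vc , rest) = ∑-update c 1 vc rest

∑-doubleDecrement : ∀ {v w : Fin N → ℕ} → DoubleDecrement v w → ∑ v ≡ 2 + ∑ w
∑-doubleDecrement {v = v} {w} (i , j , i≢j , vi , vj , rest) =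
  trans (∑-decrement v↘mid) (cong suc (∑-decrement mid↘w))
  where
  mid : Fin _ → ℕ
  mid = updateAt w i (λ _ → v i)
  mid-i : mid i ≡ v i
  mid-i = updateAt-updates i w
  mid-x : ∀ x → x ≢ i → mid x ≡ w x
  mid-x x x≢i = updateAt-minimal x i w x≢i
  v↘mid : Decrement j v mid
  v↘mid = trans vj (cong suc (sym (mid-x j (i≢j ∘ sym)))) , v≡mid
    where
    v≡mid : ∀ x → x ≢ j → v x ≡ mid x
    v≡mid x x≢j with x ≟ᶠ i
    ... | yes refl = sym mid-i
    ... | no x≢i = trans (rest x x≢i x≢j) (sym (mid-x x x≢i))
  mid↘w : Decrement i mid w
  mid↘w = trans mid-i vi , mid-x

doubleDecrement-≤ : ∀ {v w : Fin N → ℕ} → DoubleDecrement v w → ∀ x → v x ≤ suc (w x)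
doubleDecrement-≤ (i , j , _ , vi , vj , rest) x with x ≟ᶠ i | x ≟ᶠ j
... | yes refl | _        = ≤-reflexive vi
... | no _     | yes refl = ≤-reflexive vj
... | no x≢i   | no x≢j   = ≤-trans (≤-reflexive (rest x x≢i x≢j)) (n≤1+n _)

doubleDecrement-≥ : ∀ {v w : Fin N → ℕ} → DoubleDecrement v w → ∀ x → w x ≤ v x
doubleDecrement-≥ (i , j , _ , vi , vj , rest) x with x ≟ᶠ i | x ≟ᶠ j
... | yes refl | _        = ≤-trans (n≤1+n _) (≤-reflexive (sym vi))
... | no _     | yes refl = ≤-trans (n≤1+n _) (≤-reflexive (sym vj))
... | no x≢i   | no x≢j   = ≤-reflexive (sym (rest x x≢i x≢j))

∑-concentrated : ∀ (f : Fin N → ℕ) p → (∀ x → x ≢ p → f x ≡ 0) → ∑ f ≡ f p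
∑-concentrated {N} f p rest = begin
  ∑ f                   ≡⟨ ∑-update {f = λ _ → 0} p (f p) (sym (+-identityʳ (f p))) rest ⟩
  f p + ∑ {N} (λ _ → 0) ≡⟨ cong (f p +_) (sum-replicate-zero N) ⟩
  f p + 0               ≡⟨ +-identityʳ (f p) ⟩
  f p                   ∎
  where open ≡-Reasoning

∑-two : ∀ (f : Fin N → ℕ) {p c} → p ≢ c → (∀ x → x ≢ p → x ≢ c → f x ≡ 0) → ∑ f ≡ f p + f c
∑-two f {p} {c} p≢c vanishes = begin
  ∑ f        ≡⟨ ∑-update p (f p) (sym (trans (cong (f p +_) (updateAt-updates p f)) (+-identityʳ _)))
                  (λ x x≢p → sym (updateAt-minimal x p f x≢p)) ⟩
  f p + ∑ f' ≡⟨ cong (f p +_) (∑-concentrated f' c only-c) ⟩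
  f p + f' c ≡⟨ cong (f p +_) (updateAt-minimal c p f (p≢c ∘ sym)) ⟩
  f p + f c  ∎
  where
  open ≡-Reasoning
  f' : Fin _ → ℕ
  f' = updateAt f p (λ _ → 0)
  only-c : ∀ x → x ≢ c → f' x ≡ 0
  only-c x x≢c with x ≟ᶠ p
  ... | yes refl = updateAt-updates p f
  ... | no x≢p   = trans (updateAt-minimal x p f x≢p) (vanishes x x≢p x≢c)

∑-exceeds-two : ∀ (f : Fin N → ℕ) {p c} → p ≢ c → f p + f c < ∑ f →
                ∃[ j ] j ≢ p × j ≢ c × 0 < f j
∑-exceeds-two f {p} {c} p≢c f₂<∑
  with any? (λ j → ¬? (j ≟ᶠ p) ×-dec ¬? (j ≟ᶠ c) ×-dec (0 <? f j))
... | yes found = found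
... | no none = contradiction (≤-reflexive (∑-two f p≢c vanishes)) (<⇒≱ f₂<∑)
  where
  vanishes : ∀ x → x ≢ p → x ≢ c → f x ≡ 0
  vanishes x x≢p x≢c = n≤0⇒n≡0 (≮⇒≥ λ 0<fx → none (x , x≢p , x≢c , 0<fx))

∑-positive : ∀ (f : Fin N → ℕ) → 0 < ∑ f → ∃[ x ] 0 < f x
∑-positive {suc N} f 0<∑ with f Fin.zero in eq
... | suc _ = Fin.zero , subst (0 <_) (sym eq) z<s
... | zero with ∑-positive (f ∘ Fin.suc) 0<∑
...   | x , 0<fx = Fin.suc x , 0<fx

≤-∑ : ∀ (f : Fin N → ℕ) x → f x ≤ ∑ f
≤-∑ {suc N} f x = ≤-trans (m≤m+n (f x) _) (≤-reflexive (sym (sum-remove {i = x} f)))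

record SemiGreedyChoice (v : Fin N → ℕ) (c : Fin N) : Set where
  field
    largest second : Fin N
    largest≢second : largest ≢ second
    second≤largest : v second ≤ v largest
    rest≤second : ∀ j → j ≢ largest → j ≢ second → v j ≤ v second
    strict : v second < v largest → c ≡ largest
    tie : v largest ≡ v second → (∃[ j ] j ≢ largest × j ≢ second × 0 < v j) →
          c ≢ largest × c ≢ second

module _ {v : Fin N → ℕ} {c : Fin N} (sg : SemiGreedyChoice v c) where
  open SemiGreedyChoice sg

  semiGreedy-strictMax : ∀ p → (∀ j → j ≢ p → v j < v p) → c ≡ p
  semiGreedy-strictMax p below = trans (strict second<largest) largest≡p
    where
    largest≡p : largest ≡ p
    largest≡p with largest ≟ᶠ p | second ≟ᶠ p
    ... | yes eq | _ = eq
    ... | no a≢p | yes refl = contradiction second≤largest (<⇒≱ (below largest a≢p))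
    ... | no a≢p | no b≢p =
      contradiction (≤-trans (rest≤second p (a≢p ∘ sym) (b≢p ∘ sym)) second≤largest)
                    (<⇒≱ (below largest a≢p))
    second<largest : v second < v largest
    second<largest = subst (λ x → v second < v x) (sym largest≡p)
                           (below second (largest≢second ∘ trans largest≡p ∘ sym))

  semiGreedy-¬tie : ∀ p → c ≢ p → v c ≡ v p → (∀ x → x ≢ c → x ≢ p → v x < v p) →
                    ∃[ j ] j ≢ c × j ≢ p × 0 < v j → ⊥
  semiGreedy-¬tie p c≢p vc≡vp below (j , j≢c , j≢p , 0<vj) =
    ¬c∈top (tie (trans (top-value largest-top) (sym (top-value second-top)))
                (j , avoids largest-top , avoids second-top , 0<vj))
    where
    Top : Fin _ → Set
    Top x = x ≡ c ⊎ x ≡ p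
    top-value : ∀ {x} → Top x → v x ≡ v p
    top-value (inj₁ refl) = vc≡vp
    top-value (inj₂ refl) = refl
    avoids : ∀ {x} → Top x → j ≢ x
    avoids (inj₁ refl) = j≢c
    avoids (inj₂ refl) = j≢p
    top-if-≥ : ∀ x → v p ≤ v x → Top x
    top-if-≥ x vp≤vx with x ≟ᶠ c | x ≟ᶠ p
    ... | yes x≡c | _       = inj₁ x≡c
    ... | no _    | yes x≡p = inj₂ x≡p
    ... | no x≢c  | no x≢p  = contradiction vp≤vx (<⇒≱ (below x x≢c x≢p))
    bounded-by-second : ∀ x → x ≢ largest → Top x → Top second
    bounded-by-second x x≢a top with x ≟ᶠ second
    ... | yes refl = top
    ... | no x≢b   = top-if-≥ second (≤-trans (≤-reflexive (sym (top-value top))) (rest≤second x x≢a x≢b))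
    -- Of c and p, one differs from the largest part and is therefore bounded by the second.
    second-top : Top second
    second-top with largest ≟ᶠ c
    ... | yes a≡c = bounded-by-second p (λ p≡a → c≢p (sym (trans p≡a a≡c))) (inj₂ refl)
    ... | no a≢c  = bounded-by-second c (a≢c ∘ sym) (inj₁ refl)
    largest-top : Top largest
    largest-top = top-if-≥ largest (≤-trans (≤-reflexive (sym (top-value second-top))) second≤largest)
    ¬c∈top : ¬ (c ≢ largest × c ≢ second)
    ¬c∈top (c≢a , c≢b) with largest-top | second-top
    ... | inj₁ refl | _         = c≢a refl
    ... | inj₂ refl | inj₁ refl = c≢b refl
    ... | inj₂ refl | inj₂ refl = largest≢second refl

semiGreedy-leader : ∀ {v w : Fin N → ℕ} {c} p d → Decrement c v w → SemiGreedyChoice v c →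
  (∀ j → j ≢ p → w j ≤ d) → suc d ≤ w p →
  (c ≢ p → w p ≡ suc d → ∃[ j ] j ≢ c × j ≢ p × 0 < w j) → c ≡ p
semiGreedy-leader {v = v} {w} {c} p d (vc , unchanged) sg w≤d d<wp third with c ≟ᶠ p
... | yes c≡p = c≡p
... | no c≢p = ⊥-elim (by-cases (v c <? v p))
  where
  vp≡wp : v p ≡ w p
  vp≡wp = unchanged p (c≢p ∘ sym)
  d<vp : suc d ≤ v p
  d<vp = ≤-trans d<wp (≤-reflexive (sym vp≡wp))
  vc≤1+d : v c ≤ suc d
  vc≤1+d = ≤-trans (≤-reflexive vc) (s≤s (w≤d c c≢p))
  rest<vp : ∀ x → x ≢ c → x ≢ p → v x < v p
  rest<vp x x≢c x≢p = ≤-trans (s≤s (≤-trans (≤-reflexive (unchanged x x≢c)) (w≤d x x≢p))) d<vp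
  by-cases : Dec (v c < v p) → ⊥
  by-cases (yes vc<vp) = c≢p (semiGreedy-strictMax sg p below)
    where
    below : ∀ j → j ≢ p → v j < v p
    below j j≢p with j ≟ᶠ c
    ... | yes refl = vc<vp
    ... | no j≢c = rest<vp j j≢c j≢p
  by-cases (no vc≮vp) = semiGreedy-¬tie sg p c≢p vc≡vp rest<vp third-v
    where
    vc≡vp : v c ≡ v p
    vc≡vp = ≤-antisym (≤-trans vc≤1+d d<vp) (≮⇒≥ vc≮vp)
    wp≡1+d : w p ≡ suc d
    wp≡1+d = ≤-antisym (≤-trans (≤-reflexive (sym vp≡wp)) (≤-trans (≮⇒≥ vc≮vp) vc≤1+d)) d<wp
    third-v : ∃[ j ] j ≢ c × j ≢ p × 0 < v j
    third-v with third c≢p wp≡1+d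
    ... | j , j≢c , j≢p , 0<wj = j , j≢c , j≢p , ≤-trans 0<wj (≤-reflexive (sym (unchanged j j≢c)))

record Bounded (p : Fin N) (B : ℕ) (u : Fin N → ℕ) : Set where
  field
    others≤ : ∀ j → j ≢ p → u j ≤ B
    ∑≤ : ∑ u ≤ u p + (B + B)

Bounded-cong : ∀ {p : Fin N} {B} {u u' : Fin N → ℕ} → u ≗ u' → Bounded p B u → Bounded p B u'
Bounded-cong {p = p} {B} u≗u' bounded = record
  { others≤ = λ j j≢p → subst (_≤ B) (u≗u' j) (others≤ j j≢p)
  ; ∑≤ = subst₂ (λ x y → x ≤ y + (B + B)) (sum-cong-≗ u≗u') (u≗u' p) ∑≤
  }
  where open Bounded bounded

record BackwardInvariant (p : Fin N) (B : ℕ) (u : Fin N → ℕ) : Set where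
  field
    bounded : Bounded p B u
    ∑≥ : suc B + (B + B) ≤ ∑ u
  open Bounded bounded public

  leader≥ : suc B ≤ u p
  leader≥ = +-cancelʳ-≤ (B + B) (suc B) (u p) (≤-trans ∑≥ ∑≤)

module _ {p : Fin N} where

  invariant-last-round : ∀ {u w : Fin N → ℕ} → DoubleDecrement u w →
    2 ≤ w p → (∀ j → j ≢ p → w j ≡ 0) → BackwardInvariant p 1 u
  invariant-last-round {u} {w} u↘w 2≤wp empty = record
    { bounded = record
      { others≤ = λ j j≢p → ≤-trans (doubleDecrement-≤ u↘w j) (s≤s (≤-reflexive (empty j j≢p)))
      ; ∑≤ = ≤-trans (≤-reflexive ∑u≡2+wp) (≤-trans (≤-reflexive (+-comm 2 (w p)))
                                                   (+-monoˡ-≤ 2 (doubleDecrement-≥ u↘w p)))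
      }
    ; ∑≥ = ≤-trans (+-monoʳ-≤ 2 2≤wp) (≤-reflexive (sym ∑u≡2+wp))
    }
    where
    ∑u≡2+wp : ∑ u ≡ 2 + w p
    ∑u≡2+wp = trans (∑-doubleDecrement u↘w) (cong (2 +_) (∑-concentrated w p empty))

  invariant-round : ∀ {u v w : Fin N → ℕ} {c} {B} → DoubleDecrement u v → Decrement c v w →
    SemiGreedyChoice v c → BackwardInvariant p (suc B) w → BackwardInvariant p (suc (suc B)) u
  invariant-round {u} {v} {w} {c} {B} u↘v v↘w sg inv = record
    { bounded = record
      { others≤ = λ j j≢p → ≤-trans (doubleDecrement-≤ u↘v j)
                                    (s≤s (≤-trans (≤-reflexive (proj₂ v↘w j (j≢p ∘ flip trans c≡p)))
                                                  (others≤ j j≢p)))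
      ; ∑≤ = begin
          ∑ u                                     ≡⟨ ∑u≡3+∑w ⟩
          3 + ∑ w                                 ≤⟨ +-monoʳ-≤ 3 ∑≤ ⟩
          3 + (w p + (suc B + suc B))             ≡⟨ regroup (w p) B ⟩
          suc (w p) + (suc (suc B) + suc (suc B)) ≡⟨ cong (_+ _) (sym vp≡1+wp) ⟩
          v p + (suc (suc B) + suc (suc B))       ≤⟨ +-monoˡ-≤ _ (doubleDecrement-≥ u↘v p) ⟩
          u p + (suc (suc B) + suc (suc B))       ∎
      }
    ; ∑≥ = begin
        suc (suc (suc B)) + (suc (suc B) + suc (suc B)) ≡⟨ regroup′ B ⟩
        3 + (suc (suc B) + (suc B + suc B))     ≤⟨ +-monoʳ-≤ 3 ∑≥ ⟩
        3 + ∑ w                                 ≡⟨ ∑u≡3+∑w ⟨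
        ∑ u                                     ∎
    }
    where
    open BackwardInvariant inv
    open ≤-Reasoning
    regroup : ∀ x B → 3 + (x + (suc B + suc B)) ≡ suc x + (suc (suc B) + suc (suc B))
    regroup = solve-∀
    regroup′ : ∀ B → suc (suc (suc B)) + (suc (suc B) + suc (suc B)) ≡ 3 + (suc (suc B) + (suc B + suc B))
    regroup′ = solve-∀
    -- The parts other than c and p together still hold at least B + 1 vertices.
    third : c ≢ p → w p ≡ suc (suc B) → ∃[ j ] j ≢ c × j ≢ p × 0 < w j
    third c≢p wp≡ with ∑-exceeds-two w (c≢p ∘ sym) (begin-strict
        w p + w c             ≤⟨ +-mono-≤ (≤-reflexive wp≡) (others≤ c c≢p) ⟩
        suc (suc B) + suc B   <⟨ +-monoʳ-< (suc (suc B)) (m<m+n (suc B) z<s) ⟩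
        suc (suc B) + (suc B + suc B) ≤⟨ ∑≥ ⟩
        ∑ w                   ∎)
    ... | j , j≢p , j≢c , 0<wj = j , j≢c , j≢p , 0<wj
    c≡p : c ≡ p
    c≡p = semiGreedy-leader p (suc B) v↘w sg others≤ leader≥ third
    vp≡1+wp : v p ≡ suc (w p)
    vp≡1+wp = subst (λ x → v x ≡ suc (w x)) c≡p (proj₁ v↘w)
    ∑u≡3+∑w : ∑ u ≡ 3 + ∑ w
    ∑u≡3+∑w = trans (∑-doubleDecrement u↘v) (cong (2 +_) (∑-decrement v↘w))

  no-final-staller-move : ∀ {v w : Fin N → ℕ} {c i j} → Decrement c v w → SemiGreedyChoice v c →
    2 ≤ w p → (∀ x → x ≢ p → w x ≡ 0) → i ≢ j → 0 < v i → 0 < v j → ⊥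
  no-final-staller-move {v} {w} {c} {i} {j} v↘w sg 2≤wp empty i≢j 0<vi 0<vj = by-cases (i ≟ᶠ p)
    where
    c≡p : c ≡ p
    c≡p = semiGreedy-leader p 0 v↘w sg (λ x x≢p → ≤-reflexive (empty x x≢p)) (≤-trans (s≤s z≤n) 2≤wp)
            (λ _ wp≡1 → contradiction (≤-trans 2≤wp (≤-reflexive wp≡1)) (λ { (s≤s ()) }))
    nonempty : ∀ x → x ≢ p → 0 < v x → ⊥
    nonempty x x≢p 0<vx =
      contradiction (trans (proj₂ v↘w x (x≢p ∘ flip trans c≡p)) (empty x x≢p)) (>⇒≢ 0<vx)
    by-cases : Dec (i ≡ p) → ⊥
    by-cases (yes i≡p) = nonempty j (λ j≡p → i≢j (trans i≡p (sym j≡p))) 0<vj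
    by-cases (no i≢p)  = nonempty i i≢p 0<vi

even-or-odd : ∀ L → ∃[ s ] (L ≡ s + s ⊎ L ≡ suc (s + s))
even-or-odd zero = 0 , inj₁ refl
even-or-odd (suc L) with even-or-odd L
... | s , inj₁ L≡s+s   = s , inj₂ (cong suc L≡s+s)
... | s , inj₂ L≡1+s+s = suc s , inj₁ (cong suc (trans L≡1+s+s (sym (+-suc s s))))

-- U t j abstracts the number of uncovered vertices of part j after t moves.
module Trajectory (U : ℕ → Fin N → ℕ) (L : ℕ) (p : Fin N)
  (dominatorMove : ∀ q → q + q < L → DoubleDecrement (U (q + q)) (U (suc (q + q))))
  (stallerMove : ∀ q → suc (q + q) < L →
    ∃[ c ] Decrement c (U (suc (q + q))) (U (suc (suc (q + q)))) × SemiGreedyChoice (U (suc (q + q))) c)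
  (final-p : 2 ≤ U L p) (final-others : ∀ j → j ≢ p → U L j ≡ 0)
  (live : ∀ t → t < L → ∃[ i ] ∃[ j ] i ≢ j × 0 < U t i × 0 < U t j) where

  invariant : ∀ {s} → L ≡ suc (s + s) → ∀ r q → q + r ≡ s → BackwardInvariant p (suc r) (U (q + q))
  invariant {s} L≡ zero q q+0≡s =
    invariant-last-round (subst (DoubleDecrement (U (q + q)) ∘ U) last
                                (dominatorMove q (subst (q + q <_) last ≤-refl)))
                         final-p final-others
    where
    last : suc (q + q) ≡ L
    last = trans (cong (λ x → suc (x + x)) (trans (sym (+-identityʳ q)) q+0≡s)) (sym L≡)
  invariant {s} L≡ (suc r) q q+1+r≡s =
    let c , v↘w , sg = stallerMove q 1+2q<L
    in invariant-round (dominatorMove q (<-trans (n<1+n _) 1+2q<L)) v↘w sg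
                       (subst (BackwardInvariant p (suc r) ∘ U) (cong suc (+-suc q q))
                              (invariant L≡ r (suc q) (trans (sym (+-suc q r)) q+1+r≡s)))
    where
    q<s : q < s
    q<s = subst (q <_) q+1+r≡s (m<m+n q z<s)
    1+2q<L : suc (q + q) < L
    1+2q<L = subst (suc (q + q) <_) (sym L≡) (s≤s (+-mono-< q<s q<s))

  bound : ∃[ B ] Bounded p B (U 0) × B + B ∸ 1 ≤ L
  bound with even-or-odd L
  ... | s , inj₂ L≡1+s+s = suc s , BackwardInvariant.bounded (invariant L≡1+s+s s 0 refl)
                                 , ≤-reflexive (trans (+-suc s s) (sym L≡1+s+s))
  ... | zero , inj₁ refl = 0 , record
    { others≤ = λ j j≢p → ≤-reflexive (final-others j j≢p)
    ; ∑≤ = ≤-trans (≤-reflexive (∑-concentrated (U 0) p final-others)) (m≤m+n (U 0 p) 0)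
    } , z≤n
  ... | suc s , inj₁ L≡2+2s =
    let c , v↘w , sg = stallerMove s 1+2s<L
        i , j , i≢j , 0<vi , 0<vj = live (suc (s + s)) 1+2s<L
    in ⊥-elim (no-final-staller-move (subst (Decrement c (U (suc (s + s))) ∘ U) 2+2s≡L v↘w)
                                  sg final-p final-others i≢j 0<vi 0<vj)
    where
    2+2s≡L : suc (suc (s + s)) ≡ L
    2+2s≡L = sym (trans L≡2+2s (cong suc (+-suc s s)))
    1+2s<L : suc (s + s) < L
    1+2s<L = subst (suc (s + s) <_) 2+2s≡L ≤-refl

when : {A : Set} → Dec A → ℕ → ℕ
when (yes _) x = x
when (no _)  _ = 0

when-yes : ∀ {A : Set} (a? : Dec A) {x} → A → when a? x ≡ x
when-yes (yes _) _ = refl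
when-yes (no ¬a) a = contradiction a ¬a

when-no : ∀ {A : Set} (a? : Dec A) {x} → ¬ A → when a? x ≡ 0
when-no (yes a) ¬a = contradiction a ¬a
when-no (no _)  _  = refl

when-cong : ∀ {A B : Set} (a? : Dec A) (b? : Dec B) {x} → (A → B) → (B → A) → when a? x ≡ when b? x
when-cong a? b? A→B B→A with b?
... | yes b = when-yes a? (B→A b)
... | no ¬b = when-no a? (¬b ∘ A→B)

when-pos : ∀ {A : Set} (a? : Dec A) {x} → 0 < when a? x → A
when-pos (yes a) _ = a

length-filter-tabulate : ∀ {A : Set} {P : A → Set} (P? : Decidable P) (g : Fin N → A) →
  length (filter P? (tabulate g)) ≡ ∑ (λ i → when (P? (g i)) 1)
length-filter-tabulate {zero}  P? g = refl
length-filter-tabulate {suc N} P? g with P? (g Fin.zero)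
... | yes _ = cong suc (length-filter-tabulate P? (g ∘ Fin.suc))
... | no _  = length-filter-tabulate P? (g ∘ Fin.suc)

sum-filter-tabulate : ∀ {A : Set} {P : A → Set} (P? : Decidable P) (f : A → ℕ) (g : Fin N → A) →
  sum (map f (filter P? (tabulate g))) ≡ ∑ (λ i → when (P? (g i)) (f (g i)))
sum-filter-tabulate {zero}  P? f g = refl
sum-filter-tabulate {suc N} P? f g with P? (g Fin.zero)
... | yes _ = cong (f (g Fin.zero) +_) (sum-filter-tabulate P? f (g ∘ Fin.suc))
... | no _  = sum-filter-tabulate P? f (g ∘ Fin.suc)

∑-ones : ∀ N → ∑ {N} (λ _ → 1) ≡ N
∑-ones zero    = refl
∑-ones (suc N) = cong suc (∑-ones N)

module Counting {n : ℕ} (m : Fin n → ℕ) where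
  open Game m

  Endpoint : Move → Vertex → Set
  Endpoint e w = w ≡ proj₁ e ⊎ w ≡ proj₂ e

  uncovered : List Move → Vertex → ℕ
  uncovered h w = when (¬? (covered? h w)) 1

  uncov-∑ : ∀ h j → uncov h j ≡ ∑ (λ k → uncovered h (j , k))
  uncov-∑ h j = length-filter-tabulate (λ k → ¬? (covered? h (j , k))) id

  uncov-[] : ∀ j → uncov [] j ≡ m j
  uncov-[] j = trans (uncov-∑ [] j) (∑-ones (m j))

  uncov-pos : ∀ {h j k} → ¬ Covered h (j , k) → 0 < uncov h j
  uncov-pos {h} {j} {k} new = begin
    1                          ≡⟨ when-yes (¬? (covered? h (j , k))) new ⟨
    uncovered h (j , k)        ≤⟨ ≤-∑ (λ k → uncovered h (j , k)) k ⟩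
    ∑ (λ k → uncovered h (j , k)) ≡⟨ uncov-∑ h j ⟨
    uncov h j                  ∎
    where open ≤-Reasoning

  uncov-pos⁻ : ∀ {h j} → 0 < uncov h j → ∃[ k ] ¬ Covered h (j , k)
  uncov-pos⁻ {h} {j} 0<uncov with ∑-positive (λ k → uncovered h (j , k)) (subst (0 <_) (uncov-∑ h j) 0<uncov)
  ... | k , 0<unc = k , when-pos (¬? (covered? h (j , k))) 0<unc

  uncovered-cong : ∀ {h h' w} → Covered h w ⇔ Covered h' w → uncovered h w ≡ uncovered h' w
  uncovered-cong {h} {h'} {w} iff = when-cong (¬? (covered? h w)) (¬? (covered? h' w))
                                              (_∘ Equivalence.from iff) (_∘ Equivalence.to iff)

  uncov-cong : ∀ {h h' j} → (∀ k → Covered h (j , k) ⇔ Covered h' (j , k)) → uncov h j ≡ uncov h' j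
  uncov-cong {h} {h'} {j} same = begin
    uncov h j                      ≡⟨ uncov-∑ h j ⟩
    ∑ (λ k → uncovered h (j , k))  ≡⟨ sum-cong-≗ (λ k → uncovered-cong (same k)) ⟩
    ∑ (λ k → uncovered h' (j , k)) ≡⟨ uncov-∑ h' j ⟨
    uncov h' j                     ∎
    where open ≡-Reasoning

  uncov-suc : ∀ {h h' j k} → ¬ Covered h (j , k) → Covered h' (j , k) →
    (∀ k' → k' ≢ k → Covered h (j , k') ⇔ Covered h' (j , k')) → uncov h j ≡ suc (uncov h' j)
  uncov-suc {h} {h'} {j} {k} new covered same = begin
    uncov h j                      ≡⟨ uncov-∑ h j ⟩
    ∑ (λ k → uncovered h (j , k))  ≡⟨ ∑-update k 1 new-k (λ k' k'≢k → uncovered-cong (same k' k'≢k)) ⟩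
    suc (∑ (λ k → uncovered h' (j , k))) ≡⟨ cong suc (uncov-∑ h' j) ⟨
    suc (uncov h' j)               ∎
    where
    open ≡-Reasoning
    new-k : uncovered h (j , k) ≡ suc (uncovered h' (j , k))
    new-k = trans (when-yes (¬? (covered? h (j , k))) new)
                  (cong suc (sym (when-no (¬? (covered? h' (j , k))) (λ ¬c → ¬c covered))))

  covered-snoc-endpoint : ∀ h e {w} → Endpoint e w → Covered (h ++ [ e ]) w
  covered-snoc-endpoint h e endpoint = ++⁺ʳ h (here endpoint)

  covered-snoc-old : ∀ h e {w} → (Endpoint e w → Covered h w) → Covered h w ⇔ Covered (h ++ [ e ]) w
  covered-snoc-old h e old = mk⇔ ++⁺ˡ λ covered → [ id , old ∘ singleton⁻ ]′ (++⁻ h covered)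

  decrement-snoc : ∀ h e {c} → ¬ Covered h c → Endpoint e c → (∀ w → Endpoint e w → w ≢ c → Covered h w) →
    Decrement (part c) (uncov h) (uncov (h ++ [ e ]))
  decrement-snoc h e {jc , kc} new endpoint old =
    uncov-suc new (covered-snoc-endpoint h e endpoint)
              (λ k k≢kc → covered-snoc-old h e λ ep → old _ ep λ { refl → k≢kc refl }) ,
    λ j j≢jc → uncov-cong λ k → covered-snoc-old h e λ ep → old _ ep λ { refl → j≢jc refl }

  oneNew-decrement : ∀ h e {c} → OneNew h e c → Decrement (part c) (uncov h) (uncov (h ++ [ e ]))
  oneNew-decrement h e (inj₁ (refl , new , old-v)) =
    decrement-snoc h e new (inj₁ refl) λ { _ (inj₁ refl) w≢c → contradiction refl w≢c
                                         ; _ (inj₂ refl) _   → old-v }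
  oneNew-decrement h e (inj₂ (refl , new , old-u)) =
    decrement-snoc h e new (inj₂ refl) λ { _ (inj₁ refl) _   → old-u
                                         ; _ (inj₂ refl) w≢c → contradiction refl w≢c }

  twoNew-doubleDecrement : ∀ h e → IsEdge e → TwoNew h e → DoubleDecrement (uncov h) (uncov (h ++ [ e ]))
  twoNew-doubleDecrement h e@((ju , ku) , (jv , kv)) ju≢jv (new-u , new-v) =
    ju , jv , ju≢jv ,
    uncov-suc new-u (covered-snoc-endpoint h e (inj₁ refl))
      (λ k k≢ku → covered-snoc-old h e λ { (inj₁ refl) → contradiction refl k≢ku
                                          ; (inj₂ refl) → contradiction refl ju≢jv }) ,
    uncov-suc new-v (covered-snoc-endpoint h e (inj₂ refl))
      (λ k k≢kv → covered-snoc-old h e λ { (inj₁ refl) → contradiction refl ju≢jv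
                                          ; (inj₂ refl) → contradiction refl k≢kv }) ,
    λ j j≢ju j≢jv → uncov-cong λ k → covered-snoc-old h e λ { (inj₁ refl) → contradiction refl j≢ju
                                                             ; (inj₂ refl) → contradiction refl j≢jv }

  semiGreedy-choice : ∀ h e → SemiGreedy h e → ∃[ c ] OneNew h e c × SemiGreedyChoice (uncov h) (part c)
  semiGreedy-choice h e (a , b , a≢b , b≤a , rest≤b , c , one , strict , tie , _) = c , one , record
    { largest = a ; second = b ; largest≢second = a≢b ; second≤largest = b≤a ; rest≤second = rest≤b
    ; strict = strict
    ; tie = λ a≡b (j , j≢a , j≢b , 0<uncov) →
              let k , new = uncov-pos⁻ 0<uncov in tie a≡b ((j , k) , j≢a , j≢b , new)
    }

  legal-two-parts : ∀ {h e} → Legal h e → ∃[ i ] ∃[ j ] i ≢ j × 0 < uncov h i × 0 < uncov h j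
  legal-two-parts (_ , ((i , _) , (j , _)) , i≢j , _ , undominated) =
    i , j , i≢j , uncov-pos (undominated ∘ Any.map inj₁) , uncov-pos (undominated ∘ Any.map inj₂)

  legal⇒¬finished : ∀ {h e} → Legal h e → ¬ Finished h
  legal⇒¬finished (_ , f , edge , _ , undominated) finished = undominated (finished f edge)

  finished-one-part : ∀ {h i j} → Finished h → 0 < uncov h i → 0 < uncov h j → i ≡ j
  finished-one-part {h} {i} {j} finished 0<i 0<j with i ≟ᶠ j
  ... | yes i≡j = i≡j
  ... | no i≢j with uncov-pos⁻ 0<i | uncov-pos⁻ 0<j
  ...   | k , new-k | l , new-l = ⊥-elim ([ new-k , new-l ]′ (Any-⊎⁻ (finished ((i , k) , (j , l)) i≢j)))

sum-tabulate : ∀ (f : Fin N → ℕ) → sum (tabulate f) ≡ ∑ f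
sum-tabulate {zero}  f = refl
sum-tabulate {suc N} f = cong (f Fin.zero +_) (sum-tabulate (f ∘ Fin.suc))

even⇒suc-odd : ∀ t → t % 2 ≡ 0 → suc t % 2 ≡ 1
even⇒suc-odd zero _ = refl
even⇒suc-odd (suc (suc t)) even = even⇒suc-odd t even

odd⇒suc-even : ∀ t → t % 2 ≡ 1 → suc t % 2 ≡ 0
odd⇒suc-even (suc zero) _ = refl
odd⇒suc-even (suc (suc t)) odd = odd⇒suc-even t odd

double-even : ∀ q → (q + q) % 2 ≡ 0
double-even zero    = refl
double-even (suc q) = subst (λ x → suc x % 2 ≡ 0) (sym (+-suc q q)) (double-even q)

module Play {n : ℕ} (m : Fin n → ℕ) (σ : Game.Strategy m) (S : List (Game.Move m))
  (legal : (i : Fin (length S)) → Game.Legal m (take (toℕ i) S) (lookup S i))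
  (finished : Game.Finished m S)
  (dominatorMoves : (i : Fin (length S)) → toℕ i % 2 ≡ 0 →
    lookup S i ≡ σ (take (toℕ i) S) × Game.TwoNew m (take (toℕ i) S) (lookup S i))
  (stallerMoves : (i : Fin (length S)) → toℕ i % 2 ≡ 1 → Game.SemiGreedy m (take (toℕ i) S) (lookup S i))
  where
  open Game m
  open Counting m

  U : ℕ → Fin n → ℕ
  U t = uncov (take t S)

  move : ∀ {t} → t < length S → Move
  move t<L = lookup S (fromℕ< t<L)

  at : ∀ {t} (t<L : t < length S) (P : ℕ → Move → Set) →
       ((i : Fin (length S)) → P (toℕ i) (lookup S i)) → P t (move t<L)
  at t<L P hyp = subst (λ t → P t (move t<L)) (toℕ-fromℕ< t<L) (hyp (fromℕ< t<L))

  take-suc-at : ∀ {t} (t<L : t < length S) → take (suc t) S ≡ take t S ++ [ move t<L ]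
  take-suc-at t<L = at t<L (λ t e → take (suc t) S ≡ take t S ++ [ e ]) (take-suc S)

  legal-at : ∀ {t} (t<L : t < length S) → Legal (take t S) (move t<L)
  legal-at t<L = at t<L (Legal ∘ flip take S) legal

  dominator-at : ∀ {t} (t<L : t < length S) → t % 2 ≡ 0 →
    move t<L ≡ σ (take t S) × TwoNew (take t S) (move t<L)
  dominator-at t<L = at t<L (λ t e → t % 2 ≡ 0 → e ≡ σ (take t S) × TwoNew (take t S) e) dominatorMoves

  staller-at : ∀ {t} (t<L : t < length S) → t % 2 ≡ 1 → SemiGreedy (take t S) (move t<L)
  staller-at t<L = at t<L (λ t e → t % 2 ≡ 1 → SemiGreedy (take t S) e) stallerMoves

  dominatorMove : ∀ q → q + q < length S → DoubleDecrement (U (q + q)) (U (suc (q + q)))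
  dominatorMove q t<L =
    subst (DoubleDecrement (U (q + q)) ∘ uncov) (sym (take-suc-at t<L))
          (twoNew-doubleDecrement _ _ (proj₁ (legal-at t<L)) (proj₂ (dominator-at t<L (double-even q))))

  stallerMove : ∀ q → suc (q + q) < length S →
    ∃[ c ] Decrement c (U (suc (q + q))) (U (suc (suc (q + q)))) × SemiGreedyChoice (U (suc (q + q))) c
  stallerMove q t<L =
    let c , one , sg = semiGreedy-choice _ _ (staller-at t<L (even⇒suc-odd (q + q) (double-even q)))
    in part c , subst (Decrement (part c) (U (suc (q + q))) ∘ uncov) (sym (take-suc-at t<L))
                      (oneNew-decrement _ _ one)
              , sg

  final-state : 2 ≤ uncovTotal S → ∃[ p ] 2 ≤ U (length S) p × (∀ j → j ≢ p → U (length S) j ≡ 0)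
  final-state 2≤total = p , subst (λ h → 2 ≤ uncov h p) (sym take-all′) 2≤uncov-p
                           , λ j j≢p → subst (λ h → uncov h j ≡ 0) (sym take-all′) (empty j j≢p)
    where
    take-all′ : take (length S) S ≡ S
    take-all′ = take-all (length S) S ≤-refl
    total≡∑ : uncovTotal S ≡ ∑ (uncov S)
    total≡∑ = trans (cong sum (map-tabulate id (uncov S))) (sum-tabulate (uncov S))
    nonempty : ∃[ p ] 0 < uncov S p
    nonempty = ∑-positive (uncov S) (≤-trans (s≤s z≤n) (≤-trans 2≤total (≤-reflexive total≡∑)))
    p : Fin n
    p = proj₁ nonempty
    empty : ∀ j → j ≢ p → uncov S j ≡ 0
    empty j j≢p = n≤0⇒n≡0 (≮⇒≥ λ 0<j → j≢p (finished-one-part finished 0<j (proj₂ nonempty)))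
    2≤uncov-p : 2 ≤ uncov S p
    2≤uncov-p = ≤-trans 2≤total (≤-reflexive (trans total≡∑ (∑-concentrated (uncov S) p empty)))

  bound : 2 ≤ uncovTotal S → ∃[ p ] ∃[ B ] Bounded p B m × B + B ∸ 1 ≤ length S
  bound 2≤total =
    let p , 2≤Up , empty = final-state 2≤total
        B , bounded , B+B∸1≤L = Trajectory.bound U (length S) p dominatorMove stallerMove 2≤Up empty
                                  (λ t t<L → legal-two-parts (legal-at t<L))
    in p , B , Bounded-cong uncov-[] bounded , B+B∸1≤L

  Turn : Player → ℕ → Set
  Turn dominator t = t % 2 ≡ 0
  Turn staller   t = t % 2 ≡ 1

  strategy-bound : ∀ {pl k h} → SForces σ pl k h → ∀ t → h ≡ take t S → Turn pl t → length S ≤ t + k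
  strategy-bound {k = k} _ t _ _ with t <? length S
  ... | no t≮L = ≤-trans (≮⇒≥ t≮L) (m≤m+n t k)
  strategy-bound (done fin) t refl _ | yes t<L = ⊥-elim (legal⇒¬finished (legal-at t<L) fin)
  strategy-bound {k = suc k} (dmove _ forces) t refl even | yes t<L =
    ≤-trans (strategy-bound forces (suc t) next (even⇒suc-odd t even)) (≤-reflexive (sym (+-suc t k)))
    where
    next : take t S ++ [ σ (take t S) ] ≡ take (suc t) S
    next = trans (cong (λ e → take t S ++ [ e ]) (sym (proj₁ (dominator-at t<L even)))) (sym (take-suc-at t<L))
  strategy-bound {k = suc k} (smove forces) t refl odd | yes t<L =
    ≤-trans (strategy-bound (forces _ (legal-at t<L)) (suc t) (sym (take-suc-at t<L)) (odd⇒suc-even t odd))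
            (≤-reflexive (sym (+-suc t k)))

  length-≤ : ∀ {g} → Optimal g σ → length S ≤ g
  length-≤ optimal = strategy-bound optimal 0 refl refl

ceilHalf-≤ : ∀ {x B} → x ≤ B + B → ceilHalf x ≤ B
ceilHalf-≤ {x} {B} x≤2B = s≤s⁻¹ (m<n*o⇒m/o<n (begin-strict
  x + 1       ≤⟨ +-monoˡ-≤ 1 x≤2B ⟩
  B + B + 1   <⟨ n<1+n _ ⟩
  suc (B + B + 1) ≡⟨ doubled B ⟩
  suc B * 2   ∎))
  where
  open ≤-Reasoning
  doubled : ∀ B → suc (B + B + 1) ≡ suc B * 2
  doubled = solve-∀

ceilHalf-sumButLast-≤ : ∀ {m : Fin (suc N) → ℕ} {p B} → m p ≤ m (fromℕ N) → Bounded p B m →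
                        ceilHalf (sumButLast m) ≤ B
ceilHalf-sumButLast-≤ {N} {m} {p} {B} mp≤last bounded = ceilHalf-≤ (+-cancelʳ-≤ (m (fromℕ N)) _ _ (begin
  sumButLast m + m (fromℕ N) ≡⟨ cong (_+ m (fromℕ N)) sumButLast≡∑init ⟩
  ∑ (init m) + m (fromℕ N)   ≡⟨ sum-init-last m ⟨
  ∑ m                        ≤⟨ ∑≤ ⟩
  m p + (B + B)              ≤⟨ +-monoˡ-≤ (B + B) mp≤last ⟩
  m (fromℕ N) + (B + B)      ≡⟨ +-comm (m (fromℕ N)) (B + B) ⟩
  B + B + m (fromℕ N)        ∎))
  where
  open Bounded bounded
  open ≤-Reasoning
  sumButLast≡∑init : sumButLast m ≡ ∑ (init m)
  sumButLast≡∑init = begin-equality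
    sumButLast m                                    ≡⟨ sum-filter-tabulate (λ j → toℕ j <? N) m id ⟩
    ∑ (λ j → when (toℕ j <? N) (m j))              ≡⟨ sum-init-last (λ j → when (toℕ j <? N) (m j)) ⟩
    ∑ (init (λ j → when (toℕ j <? N) (m j))) + when (toℕ (fromℕ N) <? N) (m (fromℕ N))
      ≡⟨ cong₂ _+_ (sum-cong-≗ λ j → when-yes (toℕ (inject₁ j) <? N) (inject₁<N j))
                   (when-no (toℕ (fromℕ N) <? N) (<-irrefl (toℕ-fromℕ N))) ⟩
    ∑ (init m) + 0                                   ≡⟨ +-identityʳ _ ⟩
    ∑ (init m)                                       ∎
    where
    inject₁<N : ∀ j → toℕ (inject₁ j) < N
    inject₁<N j = subst (_< N) (sym (toℕ-inject₁ j)) (toℕ<n j)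

secondLast-≤ : ∀ {k} {m : Fin (suc (suc k)) → ℕ} {p B} →
               m (inject₁ (fromℕ k)) ≤ m (fromℕ (suc k)) → Bounded p B m → m (inject₁ (fromℕ k)) ≤ B
secondLast-≤ {k} {m} {p} second≤last bounded with inject₁ (fromℕ k) ≟ᶠ p
... | no second≢p = others≤ _ second≢p
  where open Bounded bounded
... | yes second≡p =
  ≤-trans second≤last (others≤ _ λ last≡p → fromℕ≢inject₁ (trans last≡p (sym second≡p)))
  where open Bounded bounded

parts-bound : ∀ {k} {m : Fin (suc (suc k)) → ℕ} → (∀ i j → i Fin.≤ j → m i ≤ m j) →
  ∀ {p B L} → Bounded p B m → B + B ∸ 1 ≤ L →
  2 * (ceilHalf (sumButLast m) ⊔ m (inject₁ (fromℕ k))) ∸ 1 ≤ L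
parts-bound {k} {m} sorted {p} {B} {L} bounded B+B∸1≤L = begin
  2 * (ceilHalf (sumButLast m) ⊔ m (inject₁ (fromℕ k))) ∸ 1
    ≤⟨ ∸-monoˡ-≤ 1 (*-monoʳ-≤ 2 (⊔-lub (ceilHalf-sumButLast-≤ (sorted p _ (≤fromℕ p)) bounded)
                                         (secondLast-≤ (sorted _ _ (≤fromℕ _)) bounded))) ⟩
  2 * B ∸ 1  ≡⟨ cong (λ x → B + x ∸ 1) (+-identityʳ B) ⟩
  B + B ∸ 1  ≤⟨ B+B∸1≤L ⟩
  L          ∎
  where open ≤-Reasoning

proposition10 :
    (n : ℕ) → (n2 : 2 ≤ n) → (m : Fin n → ℕ) →
    ((i j : Fin n) → i Fin.≤ j → m i ≤ m j) →
    (g : ℕ) → Game.IsGameValue m g →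
    (σ : Game.Strategy m) → Game.Optimal m g σ →
    (S : List (Game.Move m)) →
    ((i : Fin (length S)) → Game.Legal m (take (toℕ i) S) (lookup S i)) →
    Game.Finished m S →
    ((i : Fin (length S)) → toℕ i % 2 ≡ 0 →
      lookup S i ≡ σ (take (toℕ i) S) × Game.TwoNew m (take (toℕ i) S) (lookup S i)) →
    ((i : Fin (length S)) → toℕ i % 2 ≡ 1 →
      Game.SemiGreedy m (take (toℕ i) S) (lookup S i)) →
    2 ≤ Game.uncovTotal m S →
    length S ≤ g × 2 * (ceilHalf (sumButLast m) ⊔ m (secondLast n n2)) ∸ 1 ≤ length S
-- The game value hypothesis is not needed: the optimal strategy alone bounds |S|.
proposition10 (suc (suc k)) (s≤s (s≤s z≤n)) m sorted g _ σ optimal S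
              legal finished dominatorMoves stallerMoves 2≤total =
  let _ , _ , bounded , B+B∸1≤L = bound 2≤total
  in length-≤ optimal , parts-bound sorted bounded B+B∸1≤L
  where open Play m σ S legal finished dominatorMoves stallerMoves
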